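{- Let $\mathcal{D}_h$ be a sound abstraction of $\mathcal{D}_l$ relative to a refinement mapping $m$. Then for any ground high-level action sequence $\alpha_1,\dots,\alpha_n$ and any high-level situation-suppressed formula $\phi$: $\mathcal{D}_l\cup\mathcal{C}\models(\exists s.\,Do(m(\alpha_1,\dots,\alpha_n),S_0,s)\land m(\phi)[s])\supset\Big((\forall s.\,Do(m(\alpha_1,\dots,\alpha_n),S_0,s)\supset m(\phi)[s])\land(\exists s.\,Do(m(\alpha_1),S_0,s))\land\bigwedge_{2\le i\le n}\big(\forall s.\,Do(m(\alpha_1,\dots,\alpha_{i-1}),S_0,s)\supset\exists s'.\,Do(m(\alpha_i),s,s')\big)\Big)$.
   Context: Situation calculus setting. Objects are a countably infinite set $\mathcal{N}$ of standard names (unique names and domain closure); no function symbols other than constants; no non-fluent predicates. Situations: $S_0$ and $do(a,s)$; $do([a_1,\dots,a_n],s)$ abbreviates $do(a_n,\dots,do(a_1,s)\dots)$, also written $do(\vec a,s)$. $Poss(a,s)$ means $a$ is executable in $s$; $Executable(s)$ means every action along the history from $S_0$ to $s$ was possible where performed. A basic action theory (BAT) over finitely many action types $\mathcal{A}$ and fluents $\mathcal{F}$ consists of initial-state axioms $\mathcal{D}_{S_0}$, precondition axioms $Poss(A(\vec x),s)\equiv\phi^{Poss}_A(\vec x,s)$, successor state axioms $F(\vec x,do(a,s))\equiv\phi^{ssa}_F(\vec x,a,s)$ (right-hand sides uniform in $s$), unique names/domain closure axioms for actions $\mathcal{D}_{ca}$ and for objects $\mathcal{D}_{coa}$, and foundational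 axioms $\Sigma$. A situation-suppressed formula omits situation arguments of fluents; $\phi[s]$ restores $s$. ConGolog programs $\delta::=\alpha\mid\varphi?\mid\delta_1;\delta_2\mid\delta_1|\delta_2\mid\pi x.\delta\mid\delta^*\mid\delta_1\|\delta_2$, $nil=True?$; $\mathcal{C}$ are the axioms: $Trans(\alpha,s,\delta',s')\equiv s'=do(\alpha,s)\land Poss(\alpha,s)\land\delta'=True?$; $Trans(\varphi?,s,\delta',s')\equiv False$; $Trans(\delta_1;\delta_2,s,\delta',s')\equiv\exists\delta_1'(Trans(\delta_1,s,\delta_1',s')\land\delta'=\delta_1';\delta_2)\lor(Final(\delta_1,s)\land Trans(\delta_2,s,\delta',s'))$; $Trans(\delta_1|\delta_2,\cdot)\equiv Trans(\delta_1,\cdot)\lor Trans(\delta_2,\cdot)$; $Trans(\pi x.\delta,s,\delta',s')\equiv\exists x.Trans(\delta,s,\delta',s')$; $Trans(\delta^*,s,\delta',s')\equiv\exists\delta''(Trans(\delta,s,\delta'',s')\land\delta'=\delta'';\delta^*)$; $Trans(\delta_1\|\delta_2,s,\delta',s')\equiv\exists\delta_1'(Trans(\delta_1,s,\delta_1',s')\land\delta'=\delta_1'\|\delta_2)\lor\exists\delta_2'(Trans(\delta_2,s,\delta_2',s')\land\delta'=\delta_1\|\delta_2')$; $Final(\alpha,s)\equiv False$; $Final(\varphi?,s)\equiv\varphi[s]$; $Final(\delta_1;\delta_2,s)\equiv Final(\delta_1,s)\land Final(\delta_2,s)$; $Final(\delta_1|\delta_2,s)\equiv Final(\delta_1,s)\lor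 Final(\delta_2,s)$; $Final(\pi x.\delta,s)\equiv\exists x.Final(\delta,s)$; $Final(\delta^*,s)\equiv True$; $Final(\delta_1\|\delta_2,s)\equiv Final(\delta_1,s)\land Final(\delta_2,s)$. $Do(\delta,s,s')\doteq\exists\delta'.Trans^*(\delta,s,\delta',s')\land Final(\delta',s')$, $Trans^*$ the reflexive transitive closure. $\mathcal{D}_h$ (high-level) and $\mathcal{D}_l$ (low-level) are BATs with action types $\mathcal{A}_h,\mathcal{A}_l$ and fluents $\mathcal{F}_h,\mathcal{F}_l$, sharing only $\mathcal{N}$. A refinement mapping $m$ maps each $A\in\mathcal{A}_h$ to a situation-determined ConGolog program $m(A(\vec x))$ over $\mathcal{D}_l$ with free variables $\vec x$, and each $F\in\mathcal{F}_h$ to a situation-suppressed low-level formula $m(F(\vec x))$; $m(\phi)$ substitutes $m(F(\vec x))$ for fluent atoms; $m(\alpha_1,\dots,\alpha_n)=m(\alpha_1);\dots;m(\alpha_n)$, $m(\epsilon)=nil$. For a model $M_h$ of $\mathcal{D}_h$ and a model $M_l$ of $\mathcal{D}_l\cup\mathcal{C}$: $s_h\simeq_m^{M_h,M_l}s_l$ iff for all $F\in\mathcal{F}_h$ and assignments $v$, $M_h,v[s/s_h]\models F(\vec x,s)$ iff $M_l,v[s/s_l]\models m(F(\vec x))[s]$. A relation $B$ between situation domains is an $m$-bisimulation if each $\langle s_h,s_l\rangle\in B$ satisfies: (1) $s_h\simeq_m^{M_h,M_l}s_l$; (2) for each $A\in\mathcal{A}_h$ and $v$, if some $s_h'$ has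 $M_h,v[s/s_h,s'/s_h']\models Poss(A(\vec x),s)\land s'=do(A(\vec x),s)$ then some $s_l'$ has $M_l,v[s/s_l,s'/s_l']\models Do(m(A(\vec x)),s,s')$ and $\langle s_h',s_l'\rangle\in B$; (3) conversely, if some $s_l'$ has $M_l,v[s/s_l,s'/s_l']\models Do(m(A(\vec x)),s,s')$ then some $s_h'$ has $M_h,v[s/s_h,s'/s_h']\models Poss(A(\vec x),s)\land s'=do(A(\vec x),s)$ and $\langle s_h',s_l'\rangle\in B$. $M_h\sim_m M_l$ iff some $m$-bisimulation contains $\langle S_0^{M_h},S_0^{M_l}\rangle$. $\mathcal{D}_h$ is a sound abstraction of $\mathcal{D}_l$ relative to $m$ iff for every model $M_l$ of $\mathcal{D}_l\cup\mathcal{C}$ there is a model $M_h$ of $\mathcal{D}_h$ with $M_h\sim_m M_l$. -}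

module Defs where

open import Data.Nat using (ℕ; zero; suc; _+_)
open import Data.Fin using (Fin; zero; suc)
open import Data.Vec using (Vec; []; _∷_; lookup; map; _++_)
open import Data.List using (List; []; _∷_)
open import Data.Bool using (Bool; T)
open import Data.Product using (Σ; _×_; _,_)
open import Data.Empty using (⊥)
open import Relation.Nullary using (¬_)
open import Relation.Binary.PropositionalEquality using (_≡_)
open import Relation.Binary.Construct.Closure.ReflexiveTransitive using (Star)

-- Signatures of a basic action theory: finitely many action types and
-- fluents, each with an arity (all arguments are objects; objects are
-- the standard names ℕ).

record Sig : Set where
  field
    nA     : ℕ
    arity  : Fin nA → ℕ
    nF     : ℕ
    farity : Fin nF → ℕ          -- object arity of fluent F (situation arg. suppressed)
open Sig public

-- Ground actions A(n⃗)  (unique names + domain closure for actions)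
Action : Sig → Set
Action Σ' = Σ (Fin (nA Σ')) (λ A → Vec ℕ (arity Σ' A))

-- Situations: S₀ = [] and do(a,s) = a ∷ s  (foundational axioms Σ)
Sit : Sig → Set
Sit Σ' = List (Action Σ')

S₀ : ∀ {Σ'} → Sit Σ'
S₀ = []

do′ : ∀ {Σ'} → Action Σ' → Sit Σ' → Sit Σ'
do′ a s = a ∷ s

-- Situation-suppressed first-order formulas over a signature, with
-- n free object variables (de Bruijn indices).

data Term (n : ℕ) : Set where
  var : Fin n → Term n
  nm  : ℕ → Term n                 -- standard name

data Formula (Σ' : Sig) (n : ℕ) : Set where
  fl   : (F : Fin (nF Σ')) → Vec (Term n) (farity Σ' F) → Formula Σ' n
  _≐_  : Term n → Term n → Formula Σ' n
  ⊤f ⊥f : Formula Σ' n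
  ¬f_  : Formula Σ' n → Formula Σ' n
  _∧f_ _∨f_ _⇒f_ : Formula Σ' n → Formula Σ' n → Formula Σ' n
  ∀f ∃f : Formula Σ' (suc n) → Formula Σ' n

Subst : ℕ → ℕ → Set
Subst n m = Fin n → Term m

substT : ∀ {n m} → Subst n m → Term n → Term m
substT σ (var i) = σ i
substT σ (nm k)  = nm k

wkT : ∀ {n} → Term n → Term (suc n)
wkT (var i) = var (suc i)
wkT (nm k)  = nm k

lift : ∀ {n m} → Subst n m → Subst (suc n) (suc m)
lift σ zero    = var zero
lift σ (suc i) = wkT (σ i)

substF : ∀ {Σ' n m} → Subst n m → Formula Σ' n → Formula Σ' m
substF σ (fl F ts)  = fl F (map (substT σ) ts)
substF σ (t ≐ u)    = substT σ t ≐ substT σ u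
substF σ ⊤f         = ⊤f
substF σ ⊥f         = ⊥f
substF σ (¬f φ)     = ¬f substF σ φ
substF σ (φ ∧f ψ)   = substF σ φ ∧f substF σ ψ
substF σ (φ ∨f ψ)   = substF σ φ ∨f substF σ ψ
substF σ (φ ⇒f ψ)   = substF σ φ ⇒f substF σ ψ
substF σ (∀f φ)     = ∀f (substF (lift σ) φ)
substF σ (∃f φ)     = ∃f (substF (lift σ) φ)

-- Interpretation of the fluents at one situation (classical relations
-- as characteristic functions).
Interp : Sig → Set
Interp Σ' = (F : Fin (nF Σ')) → Vec ℕ (farity Σ' F) → Bool

evalT : ∀ {n} → Vec ℕ n → Term n → ℕ
evalT ρ (var i) = lookup ρ i
evalT ρ (nm k)  = k

-- Classical (Tarskian) satisfaction, rendered via the Gödel–Gentzen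
-- negative translation so that it is stable under double negation.
-- The object domain is exactly the standard names ℕ (domain closure).
sat : ∀ {Σ' n} → Interp Σ' → Formula Σ' n → Vec ℕ n → Set
sat I (fl F ts) ρ = T (I F (map (evalT ρ) ts))
sat I (t ≐ u)   ρ = evalT ρ t ≡ evalT ρ u
sat I ⊤f        ρ = ⊥ → ⊥
sat I ⊥f        ρ = ⊥
sat I (¬f φ)    ρ = ¬ sat I φ ρ
sat I (φ ∧f ψ)  ρ = sat I φ ρ × sat I ψ ρ
sat I (φ ∨f ψ)  ρ = ¬ (¬ sat I φ ρ × ¬ sat I ψ ρ)
sat I (φ ⇒f ψ)  ρ = sat I φ ρ → sat I ψ ρ
sat I (∀f φ)    ρ = (k : ℕ) → sat I φ (k ∷ ρ)
sat I (∃f φ)    ρ = ¬ ((k : ℕ) → ¬ sat I φ (k ∷ ρ))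

-- By unique names and domain closure for
-- actions, the right-hand sides are given per action type as
-- formulas over the object arguments:
--   Poss(A(y⃗),s) ≡ poss A (y⃗)[s]
--   F(x⃗,do(A(y⃗),s)) ≡ ssa F A (x⃗ ++ y⃗)[s]

record BAT (Σ' : Sig) : Set₁ where
  field
    DS₀  : Formula Σ' 0 → Set      -- set of initial sentences (uniform in S₀)
    poss : (A : Fin (nA Σ')) → Formula Σ' (arity Σ' A)
    ssa  : (F : Fin (nF Σ')) (A : Fin (nA Σ')) → Formula Σ' (farity Σ' F + arity Σ' A)
open BAT public

-- A structure for the language of a BAT (situation sort = action lists).
record Model (Σ' : Sig) : Set where
  field
    val  : Sit Σ' → Interp Σ'
    Poss : Action Σ' → Sit Σ' → Bool
open Model public

_⟺_ : Set → Set → Set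
P ⟺ Q = (P → Q) × (Q → P)

record ModelOf {Σ'} (D : BAT Σ') (M : Model Σ') : Set where
  field
    initOK : ∀ φ → DS₀ D φ → sat (val M (S₀ {Σ'})) φ []
    possOK : ∀ A ys s → T (Poss M (A , ys) s) ⟺ sat (val M s) (poss D A) ys
    ssaOK  : ∀ F A (xs : Vec ℕ (farity Σ' F)) ys s →
             T (val M (do′ {Σ'} (A , ys) s) F xs) ⟺ sat (val M s) (ssa D F A) (xs ++ ys)

data Prog (Σ' : Sig) (n : ℕ) : Set where
  act  : (A : Fin (nA Σ')) → Vec (Term n) (arity Σ' A) → Prog Σ' n
  _¿   : Formula Σ' n → Prog Σ' n
  _⨟_  : Prog Σ' n → Prog Σ' n → Prog Σ' n
  _∣_  : Prog Σ' n → Prog Σ' n → Prog Σ' n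
  π    : Prog Σ' (suc n) → Prog Σ' n
  _*   : Prog Σ' n → Prog Σ' n
  _∥_  : Prog Σ' n → Prog Σ' n → Prog Σ' n

nil : ∀ {Σ' n} → Prog Σ' n
nil = ⊤f ¿

substP : ∀ {Σ' n m} → Subst n m → Prog Σ' n → Prog Σ' m
substP σ (act A ts) = act A (map (substT σ) ts)
substP σ (φ ¿)      = substF σ φ ¿
substP σ (δ ⨟ γ)    = substP σ δ ⨟ substP σ γ
substP σ (δ ∣ γ)    = substP σ δ ∣ substP σ γ
substP σ (π δ)      = π (substP (lift σ) δ)
substP σ (δ *)      = substP σ δ *
substP σ (δ ∥ γ)    = substP σ δ ∥ substP σ γ

inst1 : ℕ → Subst 1 0
inst1 k zero = nm k

instVec : ∀ {n} → Vec ℕ n → Subst n 0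
instVec ys i = nm (lookup ys i)

instπ : ∀ {Σ'} → Prog Σ' 1 → ℕ → Prog Σ' 0
instπ δ k = substP (inst1 k) δ

closedT : Term 0 → ℕ
closedT t = evalT [] t

-- Trans and Final of the axioms 𝒞, in a model M.
module Semantics {Σ' : Sig} (M : Model Σ') where

  data Final : Prog Σ' 0 → Sit Σ' → Set where
    fTest : ∀ {φ s} → sat (val M s) φ [] → Final (φ ¿) s
    fSeq  : ∀ {δ₁ δ₂ s} → Final δ₁ s → Final δ₂ s → Final (δ₁ ⨟ δ₂) s
    fCh₁  : ∀ {δ₁ δ₂ s} → Final δ₁ s → Final (δ₁ ∣ δ₂) s
    fCh₂  : ∀ {δ₁ δ₂ s} → Final δ₂ s → Final (δ₁ ∣ δ₂) s
    fPi   : ∀ {δ s} (k : ℕ) → Final (instπ δ k) s → Final (π δ) s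
    fStar : ∀ {δ s} → Final (δ *) s
    fConc : ∀ {δ₁ δ₂ s} → Final δ₁ s → Final δ₂ s → Final (δ₁ ∥ δ₂) s

  data Trans : Prog Σ' 0 → Sit Σ' → Prog Σ' 0 → Sit Σ' → Set where
    tAct  : ∀ {A ts s} → T (Poss M (A , map closedT ts) s) →
            Trans (act A ts) s nil (do′ {Σ'} (A , map closedT ts) s)
    tSeq₁ : ∀ {δ₁ δ₁' δ₂ s s'} → Trans δ₁ s δ₁' s' → Trans (δ₁ ⨟ δ₂) s (δ₁' ⨟ δ₂) s'
    tSeq₂ : ∀ {δ₁ δ₂ δ' s s'} → Final δ₁ s → Trans δ₂ s δ' s' → Trans (δ₁ ⨟ δ₂) s δ' s'
    tCh₁  : ∀ {δ₁ δ₂ δ' s s'} → Trans δ₁ s δ' s' → Trans (δ₁ ∣ δ₂) s δ' s'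
    tCh₂  : ∀ {δ₁ δ₂ δ' s s'} → Trans δ₂ s δ' s' → Trans (δ₁ ∣ δ₂) s δ' s'
    tPi   : ∀ {δ δ' s s'} (k : ℕ) → Trans (instπ δ k) s δ' s' → Trans (π δ) s δ' s'
    tStar : ∀ {δ δ'' s s'} → Trans δ s δ'' s' → Trans (δ *) s (δ'' ⨟ (δ *)) s'
    tConc₁ : ∀ {δ₁ δ₁' δ₂ s s'} → Trans δ₁ s δ₁' s' → Trans (δ₁ ∥ δ₂) s (δ₁' ∥ δ₂) s'
    tConc₂ : ∀ {δ₁ δ₂ δ₂' s s'} → Trans δ₂ s δ₂' s' → Trans (δ₁ ∥ δ₂) s (δ₁ ∥ δ₂') s'

  Config : Set
  Config = Prog Σ' 0 × Sit Σ'

  Step : Config → Config → Set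
  Step (δ , s) (δ' , s') = Trans δ s δ' s'

  Trans* : Prog Σ' 0 → Sit Σ' → Prog Σ' 0 → Sit Σ' → Set
  Trans* δ s δ' s' = Star Step (δ , s) (δ' , s')

  Do : Prog Σ' 0 → Sit Σ' → Sit Σ' → Set
  Do δ s s' = Σ (Prog Σ' 0) (λ δ' → Trans* δ s δ' s' × Final δ' s')

  SituationDetermined : Prog Σ' 0 → Sit Σ' → Set
  SituationDetermined δ s =
    ∀ s' δ' δ'' → Trans* δ s δ' s' → Trans* δ s δ'' s' → δ' ≡ δ''

open Semantics public

record RefMap (H L : Sig) (Dl : BAT L) : Set₁ where
  field
    mA  : (A : Fin (nA H)) → Prog L (arity H A)
    mF  : (F : Fin (nF H)) → Formula L (farity H F)
    sd  : ∀ (Ml : Model L) → ModelOf Dl Ml →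
          ∀ A (ys : Vec ℕ (arity H A)) s →
          SituationDetermined Ml (substP (instVec ys) (mA A)) s
open RefMap public

module _ {H L : Sig} {Dl : BAT L} (m : RefMap H L Dl) where

  mFormula : ∀ {n} → Formula H n → Formula L n
  mFormula (fl F ts)  = substF (lookup ts) (mF m F)
  mFormula (t ≐ u)    = t ≐ u
  mFormula ⊤f         = ⊤f
  mFormula ⊥f         = ⊥f
  mFormula (¬f φ)     = ¬f mFormula φ
  mFormula (φ ∧f ψ)   = mFormula φ ∧f mFormula ψ
  mFormula (φ ∨f ψ)   = mFormula φ ∨f mFormula ψ
  mFormula (φ ⇒f ψ)   = mFormula φ ⇒f mFormula ψ
  mFormula (∀f φ)     = ∀f (mFormula φ)
  mFormula (∃f φ)     = ∃f (mFormula φ)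

  mAct : Action H → Prog L 0
  mAct (A , ys) = substP (instVec ys) (mA m A)

  mSeq : List (Action H) → Prog L 0
  mSeq []           = nil
  mSeq (α ∷ [])     = mAct α
  mSeq (α ∷ β ∷ αs) = mAct α ⨟ mSeq (β ∷ αs)

  MEquiv : Model H → Model L → Sit H → Sit L → Set
  MEquiv Mh Ml sh sl = ∀ F (xs : Vec ℕ (farity H F)) →
    T (val Mh sh F xs) ⟺ sat (val Ml sl) (mF m F) xs

  record IsBisim (Mh : Model H) (Ml : Model L) (B : Sit H → Sit L → Set) : Set where
    field
      equiv : ∀ sh sl → B sh sl → MEquiv Mh Ml sh sl
      forth : ∀ sh sl → B sh sl → ∀ (α : Action H) → T (Poss Mh α sh) →
              Σ (Sit L) (λ sl' → Do Ml (mAct α) sl sl' × B (do′ {H} α sh) sl')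
      back  : ∀ sh sl → B sh sl → ∀ (α : Action H) (sl' : Sit L) → Do Ml (mAct α) sl sl' →
              T (Poss Mh α sh) × B (do′ {H} α sh) sl'

  Bisimilar : Model H → Model L → Set₁
  Bisimilar Mh Ml = Σ (Sit H → Sit L → Set) (λ B → IsBisim Mh Ml B × B (S₀ {H}) (S₀ {L}))

  SoundAbstraction : BAT H → Set₁
  SoundAbstraction Dh = ∀ (Ml : Model L) → ModelOf Dl Ml →
    Σ (Model H) (λ Mh → ModelOf Dh Mh × Bisimilar Mh Ml)

module Submission where

-- Soundness yields a high-level model bisimilar to the given low-level one.
-- Its backward clause relates every low-level run of m(α₁ … αₙ) from S₀ to the
-- high-level situation do([α₁ … αₙ], S₀), which is therefore executable, and
-- m-equivalence makes φ there agree with m(φ) at the end of the run. So all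
-- runs end in m-equivalent situations and one of them satisfying m(φ) forces
-- all to; and since every prefix of the sequence is executable at the high
-- level, the forward clause of the bisimulation yields a low-level run of
-- m(αᵢ) after every run of m(α₁ … αᵢ₋₁).

open import Defs
open import Data.Nat using (ℕ)
open import Data.Fin using (zero; suc)
open import Data.Vec using (Vec; []; _∷_; lookup; map)
open import Data.Vec.Properties using (lookup-map)
open import Data.List using (List; []; _∷_; _++_)
open import Data.Product using (Σ; _×_; _,_; proj₁; proj₂)
open import Data.Unit using (⊤; tt)
open import Data.Bool using (T)
open import Relation.Nullary using (¬_)
open import Relation.Binary.PropositionalEquality using (_≡_; refl; sym; trans; cong; cong₂; subst)
open import Relation.Binary.Construct.Closure.ReflexiveTransitive using (ε; _◅_)

⟺-refl : ∀ {P} → P ⟺ P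
⟺-refl = (λ p → p) , (λ p → p)

⟺-reflexive : ∀ {P Q} → P ≡ Q → P ⟺ Q
⟺-reflexive refl = ⟺-refl

⟺-sym : ∀ {P Q} → P ⟺ Q → Q ⟺ P
⟺-sym (f , g) = g , f

⟺-trans : ∀ {P Q R} → P ⟺ Q → Q ⟺ R → P ⟺ R
⟺-trans (f , g) (f′ , g′) = (λ p → f′ (f p)) , (λ r → g (g′ r))

¬-cong : ∀ {P Q} → P ⟺ Q → (¬ P) ⟺ (¬ Q)
¬-cong (f , g) = (λ ¬p q → ¬p (g q)) , (λ ¬q p → ¬q (f p))

×-cong : ∀ {P Q P′ Q′} → P ⟺ Q → P′ ⟺ Q′ → (P × P′) ⟺ (Q × Q′)
×-cong (f , g) (f′ , g′) = (λ (p , p′) → f p , f′ p′) , (λ (q , q′) → g q , g′ q′)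

→-cong : ∀ {P Q P′ Q′} → P ⟺ Q → P′ ⟺ Q′ → (P → P′) ⟺ (Q → Q′)
→-cong (f , g) (f′ , g′) = (λ h q → f′ (h (g q))) , (λ h p → g′ (h (f p)))

Π-cong : ∀ {P Q : ℕ → Set} → (∀ k → P k ⟺ Q k) → ((k : ℕ) → P k) ⟺ ((k : ℕ) → Q k)
Π-cong e = (λ h k → proj₁ (e k) (h k)) , (λ h k → proj₂ (e k) (h k))

∨-cong : ∀ {P Q P′ Q′} → P ⟺ Q → P′ ⟺ Q′ →
         (¬ (¬ P × ¬ P′)) ⟺ (¬ (¬ Q × ¬ Q′))
∨-cong e e′ = ¬-cong (×-cong (¬-cong e) (¬-cong e′))

∃-cong : ∀ {P Q : ℕ → Set} → (∀ k → P k ⟺ Q k) →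
         (¬ ((k : ℕ) → ¬ P k)) ⟺ (¬ ((k : ℕ) → ¬ Q k))
∃-cong e = ¬-cong (Π-cong (λ k → ¬-cong (e k)))

Agrees : ∀ {n m} → Subst n m → Vec ℕ m → Vec ℕ n → Set
Agrees σ ρ ρ′ = ∀ i → evalT ρ (σ i) ≡ lookup ρ′ i

evalT-substT : ∀ {n m} {σ : Subst n m} {ρ ρ′} → Agrees σ ρ ρ′ →
               ∀ t → evalT ρ (substT σ t) ≡ evalT ρ′ t
evalT-substT a (var i) = a i
evalT-substT a (nm k)  = refl

map-evalT-substT : ∀ {n m j} {σ : Subst n m} {ρ ρ′} → Agrees σ ρ ρ′ →
                   (ts : Vec (Term n) j) → map (evalT ρ) (map (substT σ) ts) ≡ map (evalT ρ′) ts
map-evalT-substT a []       = refl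
map-evalT-substT a (t ∷ ts) = cong₂ _∷_ (evalT-substT a t) (map-evalT-substT a ts)

evalT-wkT : ∀ {n} k (ρ : Vec ℕ n) t → evalT (k ∷ ρ) (wkT t) ≡ evalT ρ t
evalT-wkT k ρ (var i) = refl
evalT-wkT k ρ (nm x)  = refl

Agrees-lift : ∀ {n m} {σ : Subst n m} {ρ ρ′} k → Agrees σ ρ ρ′ → Agrees (lift σ) (k ∷ ρ) (k ∷ ρ′)
Agrees-lift k a zero               = refl
Agrees-lift {σ = σ} {ρ} k a (suc i) = trans (evalT-wkT k ρ (σ i)) (a i)

sat-substF : ∀ {Σ′ n m} (I : Interp Σ′) {σ : Subst n m} {ρ ρ′} → Agrees σ ρ ρ′ →
             (ψ : Formula Σ′ n) → sat I (substF σ ψ) ρ ⟺ sat I ψ ρ′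
sat-substF I a (fl F ts) = ⟺-reflexive (cong (λ v → T (I F v)) (map-evalT-substT a ts))
sat-substF I a (t ≐ u)   = ⟺-reflexive (cong₂ _≡_ (evalT-substT a t) (evalT-substT a u))
sat-substF I a ⊤f        = ⟺-refl
sat-substF I a ⊥f        = ⟺-refl
sat-substF I a (¬f ψ)    = ¬-cong (sat-substF I a ψ)
sat-substF I a (ψ ∧f χ)  = ×-cong (sat-substF I a ψ) (sat-substF I a χ)
sat-substF I a (ψ ∨f χ)  = ∨-cong (sat-substF I a ψ) (sat-substF I a χ)
sat-substF I a (ψ ⇒f χ)  = →-cong (sat-substF I a ψ) (sat-substF I a χ)
sat-substF I a (∀f ψ)    = Π-cong (λ k → sat-substF I (Agrees-lift k a) ψ)
sat-substF I a (∃f ψ)    = ∃-cong (λ k → sat-substF I (Agrees-lift k a) ψ)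

-- Sit Σ′ does not determine Σ′, so the signature must be supplied at use sites.
doSeq : ∀ {Σ′} → List (Action Σ′) → Sit Σ′ → Sit Σ′
doSeq      []       s = s
doSeq {Σ′} (α ∷ αs) s = doSeq {Σ′} αs (do′ {Σ′} α s)

module _ {Σ′ : Sig} (M : Model Σ′) where

  Do-⨟-split : ∀ {δ₁ δ₂ s s″} → Do M (δ₁ ⨟ δ₂) s s″ →
               Σ (Sit Σ′) (λ s′ → Do M δ₁ s s′ × Do M δ₂ s′ s″)
  Do-⨟-split (_ , ε , fSeq f₁ f₂) = _ , (_ , ε , f₁) , (_ , ε , f₂)
  Do-⨟-split (_ , tSeq₁ t ◅ r , f) with Do-⨟-split (_ , r , f)
  ... | s′ , (δ′ , r₁ , f₁) , do₂ = s′ , (δ′ , t ◅ r₁ , f₁) , do₂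
  Do-⨟-split (_ , tSeq₂ f₁ t ◅ r , f) = _ , (_ , ε , f₁) , (_ , t ◅ r , f)

  Executable : List (Action Σ′) → Sit Σ′ → Set
  Executable []       s = ⊤
  Executable (α ∷ αs) s = T (Poss M α s) × Executable αs (do′ {Σ′} α s)

  Executable-++⁻ʳ : ∀ xs ys s → Executable (xs ++ ys) s → Executable ys (doSeq {Σ′} xs s)
  Executable-++⁻ʳ []       ys s e       = e
  Executable-++⁻ʳ (x ∷ xs) ys s (_ , e) = Executable-++⁻ʳ xs ys _ e

module _ {H L : Sig} {Dl : BAT L} (m : RefMap H L Dl) (Mh : Model H) (Ml : Model L) where

  sat-mFormula : ∀ {sh sl} → MEquiv m Mh Ml sh sl → ∀ {n} (φ : Formula H n) ρ →
                 sat (val Mh sh) φ ρ ⟺ sat (val Ml sl) (mFormula m φ) ρ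
  sat-mFormula {sl = sl} e (fl F ts) ρ =
    ⟺-trans (e F (map (evalT ρ) ts))
      (⟺-sym (sat-substF (val Ml sl) (λ i → sym (lookup-map i (evalT ρ) ts)) (mF m F)))
  sat-mFormula e (t ≐ u)  ρ = ⟺-refl
  sat-mFormula e ⊤f       ρ = ⟺-refl
  sat-mFormula e ⊥f       ρ = ⟺-refl
  sat-mFormula e (¬f φ)   ρ = ¬-cong (sat-mFormula e φ ρ)
  sat-mFormula e (φ ∧f ψ) ρ = ×-cong (sat-mFormula e φ ρ) (sat-mFormula e ψ ρ)
  sat-mFormula e (φ ∨f ψ) ρ = ∨-cong (sat-mFormula e φ ρ) (sat-mFormula e ψ ρ)
  sat-mFormula e (φ ⇒f ψ) ρ = →-cong (sat-mFormula e φ ρ) (sat-mFormula e ψ ρ)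
  sat-mFormula e (∀f φ)   ρ = Π-cong (λ k → sat-mFormula e φ (k ∷ ρ))
  sat-mFormula e (∃f φ)   ρ = ∃-cong (λ k → sat-mFormula e φ (k ∷ ρ))

module _ {H L : Sig} {Dl : BAT L} (m : RefMap H L Dl) {Mh : Model H} {Ml : Model L}
         {B : Sit H → Sit L → Set} (bisim : IsBisim m Mh Ml B) where
  open IsBisim bisim

  Do-mSeq-back : ∀ α αs {sh sl sl′} → B sh sl → Do Ml (mSeq m (α ∷ αs)) sl sl′ →
                 Executable Mh (α ∷ αs) sh × B (doSeq {H} (α ∷ αs) sh) sl′
  Do-mSeq-back α [] b run with back _ _ b α _ run
  ... | possible , b′ = (possible , tt) , b′
  Do-mSeq-back α (β ∷ αs) b run with Do-⨟-split Ml run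
  ... | _ , run₁ , run₂ with back _ _ b α _ run₁
  ... | possible , b′ with Do-mSeq-back β αs b′ run₂
  ... | exec , b″ = (possible , exec) , b″

corollary4 : (H L : Sig) (Dh : BAT H) (Dl : BAT L) (m : RefMap H L Dl) →
    SoundAbstraction m Dh →
    (α₁ : Action H) (αs : List (Action H)) →
    (k : ℕ) (φ : Formula H k) (ρ : Vec ℕ k) →
    (Ml : Model L) → ModelOf Dl Ml →
    Σ (Sit L) (λ s → Do Ml (mSeq m (α₁ ∷ αs)) (S₀ {L}) s × sat (val Ml s) (mFormula m φ) ρ) →
    ((∀ s → Do Ml (mSeq m (α₁ ∷ αs)) (S₀ {L}) s → sat (val Ml s) (mFormula m φ) ρ)
    × Σ (Sit L) (λ s → Do Ml (mAct m α₁) (S₀ {L}) s)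
    × (∀ (β : Action H) (pre : List (Action H)) (αᵢ : Action H) (post : List (Action H)) →
    α₁ ∷ αs ≡ (β ∷ pre) ++ (αᵢ ∷ post) →
    ∀ s → Do Ml (mSeq m (β ∷ pre)) (S₀ {L}) s →
    Σ (Sit L) (λ s' → Do Ml (mAct m αᵢ) s s')))
corollary4 H L Dh Dl m sound α₁ αs k φ ρ Ml ⊨Dl (s₀ , run₀ , φ₀) with sound Ml ⊨Dl
... | Mh , _ , B , bisim , B₀ = every-run-satisfies , first-step , next-step
  where
    open IsBisim bisim

    ends-bisimilar : ∀ β pre {s} → Do Ml (mSeq m (β ∷ pre)) (S₀ {L}) s → B (doSeq {H} (β ∷ pre) (S₀ {H})) s
    ends-bisimilar β pre run = proj₂ (Do-mSeq-back m bisim β pre B₀ run)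

    φ-at-end : ∀ {s} → Do Ml (mSeq m (α₁ ∷ αs)) (S₀ {L}) s →
               sat (val Mh (doSeq {H} (α₁ ∷ αs) (S₀ {H}))) φ ρ ⟺ sat (val Ml s) (mFormula m φ) ρ
    φ-at-end run = sat-mFormula m Mh Ml (equiv (doSeq {H} (α₁ ∷ αs) (S₀ {H})) _ (ends-bisimilar α₁ αs run)) φ ρ

    executable : Executable Mh (α₁ ∷ αs) (S₀ {H})
    executable = proj₁ (Do-mSeq-back m bisim α₁ αs B₀ run₀)

    every-run-satisfies : ∀ s → Do Ml (mSeq m (α₁ ∷ αs)) (S₀ {L}) s → sat (val Ml s) (mFormula m φ) ρ
    every-run-satisfies s run = proj₁ (φ-at-end run) (proj₂ (φ-at-end run₀) φ₀)

    first-step : Σ (Sit L) (λ s → Do Ml (mAct m α₁) (S₀ {L}) s)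
    first-step = let s , run , _ = forth _ _ B₀ α₁ (proj₁ executable) in s , run

    next-step : ∀ β pre αᵢ post → α₁ ∷ αs ≡ (β ∷ pre) ++ (αᵢ ∷ post) →
                ∀ s → Do Ml (mSeq m (β ∷ pre)) (S₀ {L}) s → Σ (Sit L) (λ s′ → Do Ml (mAct m αᵢ) s s′)
    next-step β pre αᵢ post split s run =
      let s′ , run′ , _ = forth (doSeq {H} (β ∷ pre) (S₀ {H})) s (ends-bisimilar β pre run) αᵢ αᵢ-possible
      in s′ , run′
      where
        αᵢ-possible : T (Poss Mh αᵢ (doSeq {H} (β ∷ pre) (S₀ {H})))
        αᵢ-possible = proj₁ (Executable-++⁻ʳ Mh (β ∷ pre) (αᵢ ∷ post) (S₀ {H})
                       (subst (λ αs′ → Executable Mh αs′ (S₀ {H})) split executable))
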